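{- Let $\tau=(\tau,A,a)$ be a primitive substitution and let $u,v$ be non-empty prefixes of $X_\tau$ with $|u|<|v|$. Then there exist an integer $k\ge 1$ and two morphisms $\lambda:R_v\to R_u^+$ and $\kappa:R_u\to R_v^+$ such that $$\tau_v\kappa=\kappa\tau_u,\quad \tau_u\lambda=\lambda\tau_v,\quad \kappa\lambda=\tau_v^k,\quad \lambda\kappa=\tau_u^k.$$
   Context: A substitution is a triple $(\tau,A,a)$ with $A$ a finite alphabet, $\tau:A\to A^+$ a morphism (extended to words and sequences by concatenation) and $a\in A$ such that $\tau(a)$ begins with $a$; $X_\tau$ is its fixed point (the unique sequence starting with $a$ with $\tau(X_\tau)=X_\tau$). It is primitive if some power of its matrix $M_\tau$ ($m_{i,j}$ = number of occurrences of $i$ in $\tau(j)$) is positive; then $X_\tau$ is uniformly recurrent. Return words: for a uniformly recurrent sequence $X$ and non-empty prefix $u$, a return word on $u$ is a factor $X_{[i,j-1]}$ where $i<j$ are two successive occurrences of $u$ in $X$. There are finitely many; $X$ decomposes uniquely as a concatenation $m_0m_1m_2\cdots$ of return words on $u$. Enumerating the return words in order of first appearance in $(m_n)$ gives a bijection $\Theta_u$ from $R_u=\{1,\dots,N\}$ ($N$ the number of return words) onto the set of return words, extended to a morphism $R_u^*\to A^*$, which is injective. For primitive $\tau$ and a non-empty prefix $u$ of $X_\tau$ there is a unique morphism $\tau_u:R_u\to R_u^+$ with $\Theta_u\tau_u=\tau\Theta_u$, called the return substitution on $u$; $(\tau_u,R_u,1)$ is a primitive substitution. Powers and compositions of morphisms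 are compositions of maps. -}

module Defs where

open import Data.Nat using (ℕ; zero; suc; _+_; _*_; _∸_; _<_; _≤_)
open import Data.Fin using (Fin; toℕ)
open import Data.Fin.Properties using (_≟_)
open import Data.List using (List; []; _∷_; length; concatMap; filter; map; [_])
open import Data.Nat.ListAction using (sum)
open import Data.List using () renaming (allFin to allFinL)
open import Data.Product using (Σ; ∃; _×_; _,_)
open import Relation.Nullary using (¬_)
open import Relation.Binary.PropositionalEquality using (_≡_; _≢_)

Word : ℕ → Set
Word n = List (Fin n)

Seq : ℕ → Set
Seq n = ℕ → Fin n

Morph : ℕ → ℕ → Set
Morph n m = Fin n → Word m

NonErasing : ∀ {n m} → Morph n m → Set
NonErasing f = ∀ x → f x ≢ []

ext : ∀ {n m} → Morph n m → Word n → Word m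
ext f w = concatMap f w

_∘ₘ_ : ∀ {n m k} → Morph m k → Morph n m → Morph n k
(f ∘ₘ g) x = ext f (g x)

idₘ : ∀ {n} → Morph n n
idₘ x = [ x ]

powₘ : ∀ {n} → Morph n n → ℕ → Morph n n
powₘ f zero = idₘ
powₘ f (suc k) = f ∘ₘ powₘ f k

_≗ₘ_ : ∀ {n m} → Morph n m → Morph n m → Set
f ≗ₘ g = ∀ x → f x ≡ g x

Matrix : ℕ → Set
Matrix n = Fin n → Fin n → ℕ

matrixOf : ∀ {n} → Morph n n → Matrix n
matrixOf τ i j = length (filter (i ≟_) (τ j))

_⊗_ : ∀ {n} → Matrix n → Matrix n → Matrix n
(M ⊗ N) i j = sum (map (λ l → M i l * N l j) (allFinL _))

identityMatrix : ∀ {n} → Matrix n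
identityMatrix i j with i ≟ j
... | Relation.Nullary.yes _ = 1
... | Relation.Nullary.no _ = 0

matPow : ∀ {n} → Matrix n → ℕ → Matrix n
matPow M zero = identityMatrix
matPow M (suc k) = M ⊗ matPow M k

Primitive : ∀ {n} → Morph n n → Set
Primitive τ = ∃ λ k → ∀ i j → 0 < matPow (matrixOf τ) (suc k) i j

seg : ∀ {n} → Seq n → ℕ → ℕ → Word n
seg X i zero = []
seg X i (suc l) = X i ∷ seg X (suc i) l

factor : ∀ {n} → Seq n → ℕ → ℕ → Word n
factor X i j = seg X i (j ∸ i)

IsPrefix : ∀ {n} → Word n → Seq n → Set
IsPrefix w X = seg X 0 (length w) ≡ w

-- X is a fixed point of τ : τ(X) = X.  Since τ is non-erasing, τ(X) is the
-- limit of τ(X_{[0,m-1]}), so τ(X) = X iff every τ(X_{[0,m-1]}) is a prefix of X.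
IsFixedPoint : ∀ {n} → Morph n n → Seq n → Set
IsFixedPoint τ X = ∀ m → IsPrefix (ext τ (seg X 0 m)) X

record Substitution (n : ℕ) : Set where
  field
    τ         : Morph n n
    nonErasing : NonErasing τ
    a         : Fin n
    rest      : Word n
    beginsA   : τ a ≡ a ∷ rest

IsFixedPointOf : ∀ {n} → Substitution n → Seq n → Set
IsFixedPointOf S X = (X 0 ≡ Substitution.a S) × IsFixedPoint (Substitution.τ S) X

OccursAt : ∀ {n} → Seq n → Word n → ℕ → Set
OccursAt X u i = seg X i (length u) ≡ u

Successive : ∀ {n} → Seq n → Word n → ℕ → ℕ → Set
Successive X u i j =
  OccursAt X u i × i < j × OccursAt X u j ×
  (∀ r → i < r → r < j → ¬ OccursAt X u r)

-- w is the return word on u starting at the occurrence i, i.e. the term of the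
-- decomposition X = m₀ m₁ m₂ ⋯ beginning at position i.
ReturnAt : ∀ {n} → Seq n → Word n → ℕ → Word n → Set
ReturnAt X u i w = ∃ λ j → Successive X u i j × w ≡ factor X i j

IsReturnWord : ∀ {n} → Seq n → Word n → Word n → Set
IsReturnWord X u w = ∃ λ i → ReturnAt X u i w

-- Θ : R_u = Fin N → A* enumerates the return words on u in order of first
-- appearance in the decomposition (m_n): it is a bijection onto the set of
-- return words, and for i < j every appearance of Θ j is preceded by an
-- appearance of Θ i.
record ReturnEnumeration {n : ℕ} (X : Seq n) (u : Word n) : Set where
  field
    N         : ℕ
    Θ         : Morph N n
    injective : ∀ i j → Θ i ≡ Θ j → i ≡ j
    sound     : ∀ i → IsReturnWord X u (Θ i)
    complete  : ∀ w → IsReturnWord X u w → ∃ λ i → Θ i ≡ w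
    ordered   : ∀ i j → toℕ i < toℕ j → ∀ p → ReturnAt X u p (Θ j) →
                ∃ λ q → q < p × ReturnAt X u q (Θ i)

record ReturnSubstitution {n : ℕ} (τ : Morph n n) (X : Seq n) (u : Word n) : Set where
  field
    enum       : ReturnEnumeration X u
  open ReturnEnumeration enum public
  field
    τᵤ         : Morph N N
    nonErasing : NonErasing τᵤ
    commutes   : (Θ ∘ₘ τᵤ) ≗ₘ (τ ∘ₘ Θ)

module Submission where

-- Take k = |v|. Every occurrence of v is one of u, so each return word on v is a concatenation
-- of return words on u; this gives λ. Unless τ(a) = a, which by primitivity forces the
-- one-letter alphabet {a}, we have |τᵏ(a)| > k, so τᵏ maps every occurrence of u in the fixed
-- point to an occurrence of v, and the τᵏ-image of each return word on u is a concatenation of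
-- return words on v; this gives κ. Return words form a code (Θᵤ and Θᵥ are injective on
-- words), so the four identities follow after applying Θ and commuting it past τ via
-- Θ τ_w = τ Θ.

open import Defs
open import Data.Nat using (ℕ; zero; suc; _+_; _*_; _∸_; _<_; _≤_; z≤n; s≤s; >-nonZero; >-nonZero⁻¹)
open import Data.Nat.Properties
open import Data.Nat.ListAction using (sum)
open import Data.Fin using (Fin)
open import Data.Fin.Properties using () renaming (_≟_ to _≟ᶠ_)
open import Data.List using (List; []; _∷_; [_]; _++_; length; map)
open import Data.List using () renaming (allFin to allFinL)
open import Data.List.Properties
  using ( ≡-dec; length-++; length-++-≤ˡ; ++-assoc; ++-identityʳ; ++-identityˡ-unique; ++-conicalˡ
        ; ∷-injective; ∷-injectiveˡ; ∷-injectiveʳ)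
open import Data.Product using (Σ; ∃; ∃₂; _×_; _,_; proj₁; proj₂)
open import Data.Sum using (inj₁; inj₂)
open import Function using (_∘_)
open import Data.Empty using (⊥; ⊥-elim)
open import Relation.Nullary using (¬_; Dec; yes; no)
open import Relation.Binary.PropositionalEquality hiding ([_])
open import Relation.Binary.Definitions using (tri<; tri≈; tri>)

private variable
  n m l : ℕ

ext-++ : (f : Morph n m) (xs ys : Word n) → ext f (xs ++ ys) ≡ ext f xs ++ ext f ys
ext-++ f []       ys = refl
ext-++ f (x ∷ xs) ys = trans (cong (f x ++_) (ext-++ f xs ys)) (sym (++-assoc (f x) _ _))

ext-∘ₘ : (f : Morph m l) (g : Morph n m) (w : Word n) → ext f (ext g w) ≡ ext (f ∘ₘ g) w
ext-∘ₘ f g []      = refl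
ext-∘ₘ f g (x ∷ w) = trans (ext-++ f (g x) (ext g w)) (cong (ext f (g x) ++_) (ext-∘ₘ f g w))

ext-cong : {f g : Morph n m} → f ≗ₘ g → (w : Word n) → ext f w ≡ ext g w
ext-cong f≗g []      = refl
ext-cong f≗g (x ∷ w) = cong₂ _++_ (f≗g x) (ext-cong f≗g w)

ext-idₘ : (w : Word n) → ext idₘ w ≡ w
ext-idₘ []      = refl
ext-idₘ (x ∷ w) = cong (x ∷_) (ext-idₘ w)

ext-square : ∀ {k} {f : Morph m k} {g : Morph n m} {h : Morph l k} {i : Morph n l} →
  (f ∘ₘ g) ≗ₘ (h ∘ₘ i) → (w : Word n) → ext f (ext g w) ≡ ext h (ext i w)
ext-square {f = f} {g} {h} {i} sq w =
  trans (ext-∘ₘ f g w) (trans (ext-cong sq w) (sym (ext-∘ₘ h i w)))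

powₘ-square : {θ : Morph m n} {σ : Morph m m} {τ : Morph n n} →
  (θ ∘ₘ σ) ≗ₘ (τ ∘ₘ θ) → ∀ k → (θ ∘ₘ powₘ σ k) ≗ₘ (powₘ τ k ∘ₘ θ)
powₘ-square {θ = θ} sq zero    x = trans (++-identityʳ (θ x)) (sym (ext-idₘ (θ x)))
powₘ-square {θ = θ} {σ} {τ} sq (suc k) x = begin
  ext θ (ext σ (powₘ σ k x))    ≡⟨ ext-square sq (powₘ σ k x) ⟩
  ext τ (ext θ (powₘ σ k x))    ≡⟨ cong (ext τ) (powₘ-square sq k x) ⟩
  ext τ (ext (powₘ τ k) (θ x))  ≡⟨ ext-∘ₘ τ (powₘ τ k) (θ x) ⟩
  ext (powₘ τ (suc k)) (θ x)    ∎
  where open ≡-Reasoning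

ext-nonEmpty : {f : Morph n m} → NonErasing f → (w : Word n) → w ≢ [] → ext f w ≢ []
ext-nonEmpty ne []      w≢[] = ⊥-elim (w≢[] refl)
ext-nonEmpty ne (x ∷ w) _    = ne x ∘ ++-conicalˡ _ _

powₘ-nonErasing : {τ : Morph n n} → NonErasing τ → ∀ k → NonErasing (powₘ τ k)
powₘ-nonErasing ne zero    x ()
powₘ-nonErasing ne (suc k) x = ext-nonEmpty ne _ (powₘ-nonErasing ne k x)

length-nonEmpty : {A : Set} (xs : List A) → xs ≢ [] → 1 ≤ length xs
length-nonEmpty []      xs≢[] = ⊥-elim (xs≢[] refl)
length-nonEmpty (x ∷ xs) _    = s≤s z≤n

length-ext : {f : Morph n m} → NonErasing f → (w : Word n) → length w ≤ length (ext f w)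
length-ext ne []      = z≤n
length-ext {f = f} ne (x ∷ w) rewrite length-++ (f x) {ext f w} =
  +-mono-≤ (length-nonEmpty (f x) (ne x)) (length-ext ne w)

++-cancel-length : {A : Set} (a c : List A) {b d : List A} →
  length a ≡ length c → a ++ b ≡ c ++ d → a ≡ c × b ≡ d
++-cancel-length []      []      _ eq = refl , eq
++-cancel-length (x ∷ a) (y ∷ c) l eq with ∷-injective eq
... | refl , eq′ with ++-cancel-length a c (suc-injective l) eq′
...   | refl , b≡d = refl , b≡d

++-cancel-≤ : {A : Set} (a c : List A) {b d : List A} →
  length a ≤ length c → a ++ b ≡ c ++ d → ∃ λ s → c ≡ a ++ s × b ≡ s ++ d
++-cancel-≤ []      c       _         eq = c , refl , eq
++-cancel-≤ (x ∷ a) (y ∷ c) (s≤s a≤c) eq with ∷-injective eq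
... | refl , eq′ with ++-cancel-≤ a c a≤c eq′
...   | s , refl , b≡ = s , refl , b≡

seg-length : (X : Seq n) (p d : ℕ) → length (seg X p d) ≡ d
seg-length X p zero    = refl
seg-length X p (suc d) = cong suc (seg-length X (suc p) d)

seg-+ : (X : Seq n) (p d e : ℕ) → seg X p (d + e) ≡ seg X p d ++ seg X (p + d) e
seg-+ X p zero    e = cong (λ q → seg X q e) (sym (+-identityʳ p))
seg-+ X p (suc d) e = cong (X p ∷_) (trans (seg-+ X (suc p) d e)
  (cong (λ q → seg X (suc p) d ++ seg X q e) (sym (+-suc p d))))

seg≡++⇒ : (X : Seq n) (p d : ℕ) (A C : Word n) → seg X p d ≡ A ++ C →
  seg X p (length A) ≡ A × seg X (p + length A) (length C) ≡ C
seg≡++⇒ X p d A C eq = ++-cancel-length _ A (seg-length X p (length A)) (begin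
  seg X p (length A) ++ seg X (p + length A) (length C) ≡⟨ sym (seg-+ X p (length A) (length C)) ⟩
  seg X p (length A + length C)                         ≡⟨ cong (seg X p) d≡ ⟩
  seg X p d                                             ≡⟨ eq ⟩
  A ++ C                                                ∎)
  where
  open ≡-Reasoning
  d≡ : length A + length C ≡ d
  d≡ = trans (sym (length-++ A)) (trans (cong length (sym eq)) (seg-length X p d))

seg≡++⇒occurs : (X : Seq n) (p d : ℕ) (A w B : Word n) → seg X p d ≡ A ++ (w ++ B) →
  OccursAt X w (p + length A)
seg≡++⇒occurs X p d A w B eq =
  proj₁ (seg≡++⇒ X (p + length A) _ w B (proj₂ (seg≡++⇒ X p d A (w ++ B) eq)))

prefix-++ : {X : Seq n} {u w : Word n} → IsPrefix u X → IsPrefix w X → length u ≤ length w →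
  ∃ λ s → w ≡ u ++ s
prefix-++ {X = X} {u} {w} pu pw u≤w = s , (begin
  w                                           ≡⟨ sym pw ⟩
  seg X 0 (length w)                          ≡⟨ cong (seg X 0) (sym (m+[n∸m]≡n u≤w)) ⟩
  seg X 0 (length u + (length w ∸ length u))  ≡⟨ seg-+ X 0 (length u) _ ⟩
  seg X 0 (length u) ++ s                     ≡⟨ cong (_++ s) pu ⟩
  u ++ s                                      ∎)
  where
  open ≡-Reasoning
  s = seg X (length u) (length w ∸ length u)

occurs-prefix : {X : Seq n} {u w : Word n} → IsPrefix u X → IsPrefix w X → length u ≤ length w →
  ∀ {p} → OccursAt X w p → OccursAt X u p
occurs-prefix {X = X} {u} pu pw u≤w {p} occ with prefix-++ pu pw u≤w
... | s , refl = proj₁ (seg≡++⇒ X p _ u s occ)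

seg-++-occurrence : (X : Seq n) {w : Word n} (p d : ℕ) → OccursAt X w (p + d) →
  seg X p d ++ w ≡ seg X p (d + length w)
seg-++-occurrence X {w} p d occ = trans (cong (seg X p d ++_) (sym occ)) (sym (seg-+ X p d (length w)))

occurs? : (X : Seq n) (w : Word n) (p : ℕ) → Dec (OccursAt X w p)
occurs? X w p = ≡-dec _≟ᶠ_ (seg X p (length w)) w

IsFixedPoint-powₘ : {τ : Morph n n} {X : Seq n} → IsFixedPoint τ X → ∀ k → IsFixedPoint (powₘ τ k) X
IsFixedPoint-powₘ {X = X} fix zero    m rewrite ext-idₘ (seg X 0 m) = cong (seg X 0) (seg-length X 0 m)
IsFixedPoint-powₘ {τ = τ} {X} fix (suc k) m =
  subst (λ w → IsPrefix w X) (trans (cong (ext τ) prefixₖ) (ext-∘ₘ τ (powₘ τ k) (seg X 0 m)))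
    (fix (length (ext (powₘ τ k) (seg X 0 m))))
  where
  prefixₖ : seg X 0 (length (ext (powₘ τ k) (seg X 0 m))) ≡ ext (powₘ τ k) (seg X 0 m)
  prefixₖ = IsFixedPoint-powₘ fix k m

-- Where the image of X_p starts in τ(X).
imagePosition : Morph n n → Seq n → ℕ → ℕ
imagePosition τ X p = length (ext τ (seg X 0 p))

imagePosition-+ : (τ : Morph n n) (X : Seq n) (p d : ℕ) →
  imagePosition τ X (p + d) ≡ imagePosition τ X p + length (ext τ (seg X p d))
imagePosition-+ τ X p d =
  trans (cong (λ w → length (ext τ w)) (seg-+ X 0 p d))
    (trans (cong length (ext-++ τ (seg X 0 p) (seg X p d))) (length-++ (ext τ (seg X 0 p))))

image-occurs : {τ : Morph n n} {X : Seq n} → IsFixedPoint τ X → (p d : ℕ) →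
  OccursAt X (ext τ (seg X p d)) (imagePosition τ X p)
image-occurs {τ = τ} {X} fix p d = proj₂ (seg≡++⇒ X 0 _ (ext τ (seg X 0 p)) (ext τ (seg X p d))
  (trans (fix (p + d)) (trans (cong (ext τ) (seg-+ X 0 p d)) (ext-++ τ (seg X 0 p) (seg X p d)))))

-- Return words

-- X[p, p+d) is a return word on w: spans are indexed by start and length rather than two positions.
record ReturnSpan (X : Seq n) (w : Word n) (p d : ℕ) : Set where
  field
    nonEmpty : 0 < d
    start    : OccursAt X w p
    end      : OccursAt X w (p + d)
    noInner  : ∀ r → 0 < r → r < d → ¬ OccursAt X w (p + r)

module _ {X : Seq n} {w : Word n} where

  Successive⇒ReturnSpan : ∀ {p q} → Successive X w p q → ReturnSpan X w p (q ∸ p)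
  Successive⇒ReturnSpan {p} {q} (occP , p<q , occQ , between) = record
    { nonEmpty = m<n⇒0<n∸m p<q
    ; start    = occP
    ; end      = subst (OccursAt X w) (sym p+d≡q) occQ
    ; noInner  = λ r 0<r r<d → between (p + r) (m<m+n p 0<r) (subst (p + r <_) p+d≡q (+-monoʳ-< p r<d))
    }
    where
    p+d≡q : p + (q ∸ p) ≡ q
    p+d≡q = m+[n∸m]≡n (<⇒≤ p<q)

  ReturnSpan⇒Successive : ∀ {p d} → ReturnSpan X w p d → Successive X w p (p + d)
  ReturnSpan⇒Successive {p} {d} span = start , m<m+n p nonEmpty , end , between
    where
    open ReturnSpan span
    between : ∀ r → p < r → r < p + d → ¬ OccursAt X w r
    between r p<r r<p+d = subst (λ q → ¬ OccursAt X w q) (m+[n∸m]≡n (<⇒≤ p<r))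
      (noInner (r ∸ p) (m<n⇒0<n∸m p<r) (m<n+o⇒m∸n<o r p {{>-nonZero nonEmpty}} r<p+d))

module ReturnWords {X : Seq n} {w : Word n} (E : ReturnEnumeration X w) where
  open ReturnEnumeration E

  locate : ∀ i → ∃₂ λ p d → ReturnSpan X w p d × Θ i ≡ seg X p d
  locate i with sound i
  ... | p , q , succ , Θi≡ = p , q ∸ p , Successive⇒ReturnSpan succ , Θi≡

  returnWord : ∀ {p d} → ReturnSpan X w p d → ∃ λ i → Θ i ≡ seg X p d
  returnWord {p} {d} span =
    complete _ (p , p + d , ReturnSpan⇒Successive span , cong (seg X p) (sym (m+n∸m≡n p d)))

  -- decomposeAfterGap scans for the next occurrence of w after p, knowing there is none in (p, p+g).
  decompose : ∀ p d → OccursAt X w p → OccursAt X w (p + d) → ∃ λ ws → ext Θ ws ≡ seg X p d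
  decomposeAfterGap : ∀ d {p g} → 0 < g → OccursAt X w p →
    (∀ r → 0 < r → r < g → ¬ OccursAt X w (p + r)) →
    OccursAt X w (p + (g + d)) → ∃ λ ws → ext Θ ws ≡ seg X p (g + d)

  decompose p zero    _    _    = [] , refl
  decompose p (suc d) occP occE = decomposeAfterGap d (s≤s z≤n) occP noneBelow1 occE
    where
    noneBelow1 : ∀ r → 0 < r → r < 1 → ¬ OccursAt X w (p + r)
    noneBelow1 (suc r) _ (s≤s ())

  decomposeAfterGap zero {p} {g} 0<g occP gap occE
    with returnWord (record { nonEmpty = 0<g ; start = occP ; noInner = gap
                            ; end = subst (λ e → OccursAt X w (p + e)) (+-identityʳ g) occE })
  ... | i , Θi≡ = [ i ] , trans (++-identityʳ (Θ i)) (trans Θi≡ (cong (seg X p) (sym (+-identityʳ g))))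
  decomposeAfterGap (suc d) {p} {g} 0<g occP gap occE with occurs? X w (p + g)
  ... | yes occG
    with returnWord (record { nonEmpty = 0<g ; start = occP ; end = occG ; noInner = gap })
       | decompose (p + g) (suc d) occG (subst (OccursAt X w) (sym (+-assoc p g (suc d))) occE)
  ...   | i , Θi≡ | ws , ws≡ = i ∷ ws , trans (cong₂ _++_ Θi≡ ws≡) (sym (seg-+ X p g (suc d)))
  decomposeAfterGap (suc d) {p} {g} 0<g occP gap occE | no ¬occG
    with decomposeAfterGap d (s≤s z≤n) occP gap′ (subst (λ e → OccursAt X w (p + e)) (+-suc g d) occE)
    where
    gap′ : ∀ r → 0 < r → r < suc g → ¬ OccursAt X w (p + r)
    gap′ r 0<r r<1+g with m≤n⇒m<n∨m≡n (≤-pred r<1+g)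
    ... | inj₁ r<g  = gap r 0<r r<g
    ... | inj₂ refl = ¬occG
  ... | ws , ws≡ = ws , trans ws≡ (cong (seg X p) (sym (+-suc g d)))

  Θ-nonErasing : NonErasing Θ
  Θ-nonErasing i Θi≡[] with locate i
  ... | p , zero  , span , _   = <-irrefl refl (ReturnSpan.nonEmpty span)
  ... | p , suc d , _    , Θi≡ with trans (sym Θi≡[]) Θi≡
  ...   | ()

  Θ-++-startsWith : ∀ i → ∃ λ t → Θ i ++ w ≡ w ++ t
  Θ-++-startsWith i with locate i
  ... | p , d , span , Θi≡ = t , (begin
    Θ i ++ w                 ≡⟨ cong (_++ w) Θi≡ ⟩
    seg X p d ++ w           ≡⟨ seg-++-occurrence X p d (ReturnSpan.end span) ⟩
    seg X p (d + length w)   ≡⟨ cong (seg X p) (+-comm d (length w)) ⟩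
    seg X p (length w + d)   ≡⟨ seg-+ X p (length w) d ⟩
    seg X p (length w) ++ t  ≡⟨ cong (_++ t) (ReturnSpan.start span) ⟩
    w ++ t                   ∎)
    where
    open ≡-Reasoning
    t = seg X (p + length w) d

  ext-Θ-++-startsWith : ∀ ws → ∃ λ t → ext Θ ws ++ w ≡ w ++ t
  ext-Θ-++-startsWith []       = [] , sym (++-identityʳ w)
  ext-Θ-++-startsWith (i ∷ ws) with ext-Θ-++-startsWith ws | Θ-++-startsWith i
  ... | t , ws≡ | t′ , i≡ = t′ ++ t , (begin
    (Θ i ++ ext Θ ws) ++ w ≡⟨ ++-assoc (Θ i) _ w ⟩
    Θ i ++ (ext Θ ws ++ w) ≡⟨ cong (Θ i ++_) ws≡ ⟩
    Θ i ++ (w ++ t)        ≡⟨ sym (++-assoc (Θ i) w t) ⟩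
    (Θ i ++ w) ++ t        ≡⟨ cong (_++ t) i≡ ⟩
    (w ++ t′) ++ t         ≡⟨ ++-assoc w t′ t ⟩
    w ++ (t′ ++ t)         ∎)
    where open ≡-Reasoning

  noInnerOccurrence : ∀ j (A B : Word n) → Θ j ++ w ≡ A ++ (w ++ B) →
    0 < length A → length A < length (Θ j) → ⊥
  noInnerOccurrence j A B eq 0<|A| |A|<|Θj| with locate j
  ... | p , d , span , Θj≡ = ReturnSpan.noInner span (length A) 0<|A|
    (subst (length A <_) (trans (cong length Θj≡) (seg-length X p d)) |A|<|Θj|)
    (seg≡++⇒occurs X p _ A w B
      (trans (sym (seg-++-occurrence X p d (ReturnSpan.end span))) (trans (cong (_++ w) (sym Θj≡)) eq)))

  shorterΘ-impossible : ∀ i j {t₁ t₂} → length (Θ i) < length (Θ j) →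
    Θ i ++ (w ++ t₁) ≡ Θ j ++ (w ++ t₂) → ⊥
  shorterΘ-impossible i j {t₁} {t₂} |Θi|<|Θj| eq
    with ++-cancel-≤ (Θ i) (Θ j) (<⇒≤ |Θi|<|Θj|) eq
  ... | s , Θj≡ , wt₁≡
    with ++-cancel-≤ w (s ++ w) (subst (length w ≤_) (sym (length-++ s)) (m≤n+m _ _))
                     (trans wt₁≡ (sym (++-assoc s w t₂)))
  ...   | s′ , sw≡ , _ = noInnerOccurrence j (Θ i) s′ (begin
    Θ j ++ w          ≡⟨ cong (_++ w) Θj≡ ⟩
    (Θ i ++ s) ++ w   ≡⟨ ++-assoc (Θ i) s w ⟩
    Θ i ++ (s ++ w)   ≡⟨ cong (Θ i ++_) sw≡ ⟩
    Θ i ++ (w ++ s′)  ∎) (length-nonEmpty (Θ i) (Θ-nonErasing i)) |Θi|<|Θj|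
    where open ≡-Reasoning

  Θ-++-cancel : ∀ i j {t₁ t₂} → Θ i ++ (w ++ t₁) ≡ Θ j ++ (w ++ t₂) → Θ i ≡ Θ j
  Θ-++-cancel i j eq with <-cmp (length (Θ i)) (length (Θ j))
  ... | tri< lt _ _ = ⊥-elim (shorterΘ-impossible i j lt eq)
  ... | tri≈ _ eq′ _ = proj₁ (++-cancel-length (Θ i) (Θ j) eq′ eq)
  ... | tri> _ _ gt = ⊥-elim (shorterΘ-impossible j i gt (sym eq))

  -- Appending w puts an occurrence of w after every return word, so the two leading return
  -- words must have equal length (shorterΘ-impossible).
  ext-Θ-++-injective : ∀ ws₁ ws₂ → ext Θ ws₁ ++ w ≡ ext Θ ws₂ ++ w → ws₁ ≡ ws₂
  ext-Θ-++-injective []       []       _  = refl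
  ext-Θ-++-injective []       (j ∷ ws) eq =
    ⊥-elim (Θ-nonErasing j (++-conicalˡ (Θ j) _ (++-identityˡ-unique (Θ j ++ ext Θ ws) eq)))
  ext-Θ-++-injective (i ∷ ws) []       eq =
    ⊥-elim (Θ-nonErasing i (++-conicalˡ (Θ i) _ (++-identityˡ-unique (Θ i ++ ext Θ ws) (sym eq))))
  ext-Θ-++-injective (i ∷ ws₁) (j ∷ ws₂) eq
    with ext-Θ-++-startsWith ws₁ | ext-Θ-++-startsWith ws₂
  ... | t₁ , ws₁≡ | t₂ , ws₂≡ = cong₂ _∷_ (injective i j Θi≡Θj) (ext-Θ-++-injective ws₁ ws₂ tails≡)
    where
    eq′ : Θ i ++ (ext Θ ws₁ ++ w) ≡ Θ j ++ (ext Θ ws₂ ++ w)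
    eq′ = trans (sym (++-assoc (Θ i) _ w)) (trans eq (++-assoc (Θ j) _ w))
    Θi≡Θj : Θ i ≡ Θ j
    Θi≡Θj = Θ-++-cancel i j (trans (cong (Θ i ++_) (sym ws₁≡)) (trans eq′ (cong (Θ j ++_) ws₂≡)))
    tails≡ : ext Θ ws₁ ++ w ≡ ext Θ ws₂ ++ w
    tails≡ = proj₂ (++-cancel-length (Θ i) (Θ j) (cong length Θi≡Θj) eq′)

  ext-Θ-injective : ∀ ws₁ ws₂ → ext Θ ws₁ ≡ ext Θ ws₂ → ws₁ ≡ ws₂
  ext-Θ-injective ws₁ ws₂ eq = ext-Θ-++-injective ws₁ ws₂ (cong (_++ w) eq)

-- Conjugacy of two return substitutions

module Conjugacy {τ : Morph n n} (τ-nonErasing : NonErasing τ) {X : Seq n} (fix : IsFixedPoint τ X)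
  {u v : Word n} (v⇒u : ∀ {p} → OccursAt X v p → OccursAt X u p)
  (Ru : ReturnSubstitution τ X u) (Rv : ReturnSubstitution τ X v) (k : ℕ)
  (u⇒v : ∀ {p} → OccursAt X u p → OccursAt X v (imagePosition (powₘ τ k) X p)) where

  private
    module U = ReturnSubstitution Ru
    module V = ReturnSubstitution Rv
    module RU = ReturnWords U.enum
    module RV = ReturnWords V.enum
    T = powₘ τ k

  lamSpec : ∀ j → ∃ λ ws → ext U.Θ ws ≡ V.Θ j
  lamSpec j with RV.locate j
  ... | p , d , span , Θj≡ =
    let ws , ws≡ = RU.decompose p d (v⇒u (ReturnSpan.start span)) (v⇒u (ReturnSpan.end span))
    in ws , trans ws≡ (sym Θj≡)

  lam : Morph V.N U.N
  lam j = proj₁ (lamSpec j)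

  kapSpec : ∀ i → ∃ λ ws → ext V.Θ ws ≡ ext T (U.Θ i)
  kapSpec i with RU.locate i
  ... | p , d , span , Θi≡ =
    let ws , ws≡ = RV.decompose (imagePosition T X p) (length (ext T (seg X p d)))
                     (u⇒v (ReturnSpan.start span))
                     (subst (OccursAt X v) (imagePosition-+ T X p d) (u⇒v (ReturnSpan.end span)))
    in ws , trans ws≡ (trans (image-occurs (IsFixedPoint-powₘ fix k) p d) (cong (ext T) (sym Θi≡)))

  kap : Morph U.N V.N
  kap i = proj₁ (kapSpec i)

  open ≡-Reasoning

  ext-lam : ∀ ws → ext U.Θ (ext lam ws) ≡ ext V.Θ ws
  ext-lam ws = trans (ext-∘ₘ U.Θ lam ws) (ext-cong (proj₂ ∘ lamSpec) ws)

  ext-kap : ∀ ws → ext V.Θ (ext kap ws) ≡ ext T (ext U.Θ ws)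
  ext-kap = ext-square (proj₂ ∘ kapSpec)

  lam-nonErasing : NonErasing lam
  lam-nonErasing j lamj≡[] =
    RV.Θ-nonErasing j (trans (sym (proj₂ (lamSpec j))) (cong (ext U.Θ) lamj≡[]))

  kap-nonErasing : NonErasing kap
  kap-nonErasing i kapi≡[] =
    ext-nonEmpty (powₘ-nonErasing τ-nonErasing k) (U.Θ i) (RU.Θ-nonErasing i)
      (trans (sym (proj₂ (kapSpec i))) (cong (ext V.Θ) kapi≡[]))

  τ-T-commute : ∀ w → ext τ (ext T w) ≡ ext T (ext τ w)
  τ-T-commute = ext-square (powₘ-square (λ _ → refl) k)

  τᵥ∘kap≗kap∘τᵤ : (V.τᵤ ∘ₘ kap) ≗ₘ (kap ∘ₘ U.τᵤ)
  τᵥ∘kap≗kap∘τᵤ i = RV.ext-Θ-injective _ _ (begin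
    ext V.Θ (ext V.τᵤ (kap i)) ≡⟨ ext-square V.commutes (kap i) ⟩
    ext τ (ext V.Θ (kap i))    ≡⟨ cong (ext τ) (proj₂ (kapSpec i)) ⟩
    ext τ (ext T (U.Θ i))      ≡⟨ τ-T-commute (U.Θ i) ⟩
    ext T (ext τ (U.Θ i))      ≡⟨ cong (ext T) (sym (U.commutes i)) ⟩
    ext T (ext U.Θ (U.τᵤ i))   ≡⟨ sym (ext-kap (U.τᵤ i)) ⟩
    ext V.Θ (ext kap (U.τᵤ i)) ∎)

  τᵤ∘lam≗lam∘τᵥ : (U.τᵤ ∘ₘ lam) ≗ₘ (lam ∘ₘ V.τᵤ)
  τᵤ∘lam≗lam∘τᵥ j = RU.ext-Θ-injective _ _ (begin
    ext U.Θ (ext U.τᵤ (lam j)) ≡⟨ ext-square U.commutes (lam j) ⟩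
    ext τ (ext U.Θ (lam j))    ≡⟨ cong (ext τ) (proj₂ (lamSpec j)) ⟩
    ext τ (V.Θ j)              ≡⟨ sym (V.commutes j) ⟩
    ext V.Θ (V.τᵤ j)           ≡⟨ sym (ext-lam (V.τᵤ j)) ⟩
    ext U.Θ (ext lam (V.τᵤ j)) ∎)

  kap∘lam≗τᵥᵏ : (kap ∘ₘ lam) ≗ₘ powₘ V.τᵤ k
  kap∘lam≗τᵥᵏ j = RV.ext-Θ-injective _ _ (begin
    ext V.Θ (ext kap (lam j)) ≡⟨ ext-kap (lam j) ⟩
    ext T (ext U.Θ (lam j))   ≡⟨ cong (ext T) (proj₂ (lamSpec j)) ⟩
    ext T (V.Θ j)             ≡⟨ sym (powₘ-square V.commutes k j) ⟩
    ext V.Θ (powₘ V.τᵤ k j)   ∎)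

  lam∘kap≗τᵤᵏ : (lam ∘ₘ kap) ≗ₘ powₘ U.τᵤ k
  lam∘kap≗τᵤᵏ i = RU.ext-Θ-injective _ _ (begin
    ext U.Θ (ext lam (kap i)) ≡⟨ ext-lam (kap i) ⟩
    ext V.Θ (kap i)           ≡⟨ proj₂ (kapSpec i) ⟩
    ext T (U.Θ i)             ≡⟨ sym (powₘ-square U.commutes k i) ⟩
    ext U.Θ (powₘ U.τᵤ k i)   ∎)

  conjugacy : Σ (Morph V.N U.N) λ lam → Σ (Morph U.N V.N) λ kap →
    NonErasing lam × NonErasing kap ×
    ((V.τᵤ ∘ₘ kap) ≗ₘ (kap ∘ₘ U.τᵤ)) × ((U.τᵤ ∘ₘ lam) ≗ₘ (lam ∘ₘ V.τᵤ)) ×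
    ((kap ∘ₘ lam) ≗ₘ powₘ V.τᵤ k) × ((lam ∘ₘ kap) ≗ₘ powₘ U.τᵤ k)
  conjugacy = lam , kap , lam-nonErasing , kap-nonErasing ,
    τᵥ∘kap≗kap∘τᵤ , τᵤ∘lam≗lam∘τᵥ , kap∘lam≗τᵥᵏ , lam∘kap≗τᵤᵏ

-- The exponent k = |v|

sum-pos : (g : Fin n → ℕ) (xs : List (Fin n)) → 0 < sum (map g xs) → ∃ λ l → 0 < g l
sum-pos g []       ()
sum-pos g (x ∷ xs) pos with g x in gx≡
... | zero  = sum-pos g xs pos
... | suc _ = x , subst (0 <_) (sym gx≡) (s≤s z≤n)

*-pos⁻ : ∀ a b → 0 < a * b → 0 < a × 0 < b
*-pos⁻ a b pos =
  >-nonZero⁻¹ a {{m*n≢0⇒m≢0 a {{>-nonZero pos}}}} , >-nonZero⁻¹ b {{m*n≢0⇒n≢0 a {{>-nonZero pos}}}}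

column-of-fixed-letter : {τ : Morph n n} {a : Fin n} → τ a ≡ [ a ] →
  ∀ k i → 0 < matPow (matrixOf τ) k i a → i ≡ a
column-of-fixed-letter {a = a} τa≡ zero i pos with i ≟ᶠ a
... | yes i≡a = i≡a
column-of-fixed-letter {τ = τ} {a} τa≡ (suc k) i pos
  with sum-pos (λ l → matrixOf τ i l * matPow (matrixOf τ) k l a) (allFinL _) pos
... | l , pos′ with *-pos⁻ (matrixOf τ i l) _ pos′
...   | posᵢₗ , posₗₐ with column-of-fixed-letter {τ = τ} τa≡ k l posₗₐ
...     | refl rewrite τa≡ with i ≟ᶠ a
...       | yes i≡a = i≡a

primitive-fixed-letter : {τ : Morph n n} {a : Fin n} → Primitive τ → τ a ≡ [ a ] → ∀ x → x ≡ a
primitive-fixed-letter {τ = τ} (k , pos) τa≡ x = column-of-fixed-letter {τ = τ} τa≡ (suc k) x (pos x _)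

unary-words-≡ : {a : Fin n} → (∀ x → x ≡ a) → (w₁ w₂ : Word n) → length w₁ ≡ length w₂ → w₁ ≡ w₂
unary-words-≡ unary []       []       _ = refl
unary-words-≡ unary (x ∷ w₁) (y ∷ w₂) l =
  cong₂ _∷_ (trans (unary x) (sym (unary y))) (unary-words-≡ unary w₁ w₂ (suc-injective l))

powₘ-growth : {τ : Morph n n} {a r : Fin n} {rs : Word n} → NonErasing τ → τ a ≡ a ∷ r ∷ rs →
  ∀ k → ∃ λ w → powₘ τ k a ≡ a ∷ w × k ≤ length w
powₘ-growth ne τa≡ zero = [] , refl , z≤n
powₘ-growth {τ = τ} {r = r} {rs} ne τa≡ (suc k) with powₘ-growth ne τa≡ k
... | w , τᵏa≡ , k≤|w| =
  r ∷ rs ++ ext τ w , trans (cong (ext τ) τᵏa≡) (cong (_++ ext τ w) τa≡) , s≤s (≤-trans k≤|w| |w|≤)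
  where
  |w|≤ : length w ≤ length (rs ++ ext τ w)
  |w|≤ = ≤-trans (length-ext ne w) (subst (length (ext τ w) ≤_) (sym (length-++ rs)) (m≤n+m _ _))

prefix-head : {X : Seq n} {u : Word n} → u ≢ [] → IsPrefix u X → ∃ λ u′ → u ≡ X 0 ∷ u′
prefix-head {u = []}     u≢[] _  = ⊥-elim (u≢[] refl)
prefix-head {u = x ∷ u′} _    pu = u′ , cong (_∷ u′) (sym (∷-injectiveˡ pu))

occurrence-transfer : (S : Substitution n) → Primitive (Substitution.τ S) →
  (X : Seq n) → IsFixedPointOf S X → {u v : Word n} → u ≢ [] → IsPrefix u X → IsPrefix v X →
  ∀ {p} → OccursAt X u p → OccursAt X v (imagePosition (powₘ (Substitution.τ S) (length v)) X p)
occurrence-transfer S prim X (X0≡a , fix) {u} {v} u≢[] pu pv {p} occ = transfer rest beginsA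
  where
  open Substitution S
  T = powₘ τ (length v)
  P′ = imagePosition T X p

  transfer : ∀ r → τ a ≡ a ∷ r → OccursAt X v P′
  transfer [] τa≡ =
    unary-words-≡ (primitive-fixed-letter {τ = τ} prim τa≡) _ v (seg-length X P′ (length v))
  transfer (r ∷ rs) τa≡ = occurs-prefix pv prefixTu |v|≤|Tu| occTu
    where
    occTu : OccursAt X (ext T u) P′
    occTu = subst (λ w → OccursAt X (ext T w) P′) occ
      (image-occurs (IsFixedPoint-powₘ fix (length v)) p (length u))
    prefixTu : IsPrefix (ext T u) X
    prefixTu = subst (λ w → IsPrefix (ext T w) X) pu (IsFixedPoint-powₘ fix (length v) (length u))
    |v|≤|Tu| : length v ≤ length (ext T u)
    |v|≤|Tu| with prefix-head u≢[] pu | powₘ-growth nonErasing τa≡ (length v)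
    ... | u′ , refl | w , Ta≡ , |v|≤|w| rewrite X0≡a | Ta≡ =
      ≤-trans (m≤n⇒m≤1+n |v|≤|w|) (length-++-≤ˡ (a ∷ w))

mainTheorem4 : ∀ {n} (S : Substitution n) → Primitive (Substitution.τ S) →
    (X : Seq n) → IsFixedPointOf S X →
    (u v : Word n) → u ≢ [] → v ≢ [] → IsPrefix u X → IsPrefix v X →
    length u < length v →
    (Ru : ReturnSubstitution (Substitution.τ S) X u) →
    (Rv : ReturnSubstitution (Substitution.τ S) X v) →
    ∃ λ k → 1 ≤ k ×
      Σ (Morph (ReturnSubstitution.N Rv) (ReturnSubstitution.N Ru)) λ lam →
      Σ (Morph (ReturnSubstitution.N Ru) (ReturnSubstitution.N Rv)) λ kap →
        NonErasing lam × NonErasing kap ×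
        ((ReturnSubstitution.τᵤ Rv ∘ₘ kap) ≗ₘ (kap ∘ₘ ReturnSubstitution.τᵤ Ru)) ×
        ((ReturnSubstitution.τᵤ Ru ∘ₘ lam) ≗ₘ (lam ∘ₘ ReturnSubstitution.τᵤ Rv)) ×
        ((kap ∘ₘ lam) ≗ₘ powₘ (ReturnSubstitution.τᵤ Rv) k) ×
        ((lam ∘ₘ kap) ≗ₘ powₘ (ReturnSubstitution.τᵤ Ru) k)
mainTheorem4 S prim X fixedPoint@(_ , fix) u v u≢[] v≢[] pu pv |u|<|v| Ru Rv =
  length v , length-nonEmpty v v≢[] ,
  Conjugacy.conjugacy (Substitution.nonErasing S) fix (occurs-prefix pu pv (<⇒≤ |u|<|v|))
    Ru Rv (length v)
    (occurrence-transfer S prim X fixedPoint u≢[] pu pv)
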